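{- For any connected vertex transitive digraph $D$, its cycle graph $C(D)$ is nearly transitive.
   Context: All digraphs are finite, without loops or multiple arcs (pairs of opposite arcs allowed); a directed cycle has length at least $2$. A digraph is vertex transitive if its automorphism group acts transitively on its vertices; it is connected if its underlying undirected graph is connected. The cycle graph $C(D)$ is the undirected graph whose vertices are the directed cycles of $D$, two being adjacent iff they share at least one vertex. An undirected graph $G$ is nearly transitive if for any two vertices $u,v\in V(G)$ there is an automorphism of $G$ mapping $v$ either to $u$ or to a neighbor of $u$. -}

module Defs where

open import Data.Nat using (ℕ; _≤_)
open import Data.Bool using (Bool; false; T)
open import Data.Fin using (Fin)
open import Data.Fin.Permutation using (Permutation′; _⟨$⟩ʳ_)
open import Data.List using (List; []; _∷_; _++_; [_]; length)
open import Data.List.Relation.Unary.Unique.Propositional using (Unique)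
open import Data.List.Membership.Propositional using (_∈_)
open import Data.Product using (Σ; ∃; _×_; _,_; proj₁)
open import Data.Sum using (_⊎_)
open import Data.Unit using (⊤)
open import Data.Empty using (⊥)
open import Relation.Nullary using (¬_)
open import Relation.Binary.PropositionalEquality using (_≡_)

-- A finite digraph on vertex set Fin n: loopless, no multiple arcs
-- (arc relation is Bool-valued); opposite arcs allowed.
record Digraph : Set where
  field
    n        : ℕ
    arc      : Fin n → Fin n → Bool
    loopless : ∀ v → arc v v ≡ false
open Digraph public

Vtx : Digraph → Set
Vtx D = Fin (n D)

Arc : (D : Digraph) → Vtx D → Vtx D → Set
Arc D u v = T (arc D u v)

IsDigraphAut : (D : Digraph) → Permutation′ (n D) → Set
IsDigraphAut D σ = ∀ u v → arc D (σ ⟨$⟩ʳ u) (σ ⟨$⟩ʳ v) ≡ arc D u v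

VertexTransitive : Digraph → Set
VertexTransitive D =
  ∀ u v → Σ (Permutation′ (n D)) λ σ → IsDigraphAut D σ × (σ ⟨$⟩ʳ u ≡ v)

data UWalk (D : Digraph) : Vtx D → Vtx D → Set where
  here : ∀ {u} → UWalk D u u
  step : ∀ {u v w} → (Arc D u v ⊎ Arc D v u) → UWalk D v w → UWalk D u w

Connected : Digraph → Set
Connected D = ∀ u v → UWalk D u v

-- Directed cycles, represented by the cyclic list of their vertices
-- v0 v1 ... v(k-1) with arcs v_i → v_(i+1) and v(k-1) → v0.
PathArcs : (D : Digraph) → Vtx D → List (Vtx D) → Set
PathArcs D a []       = ⊤
PathArcs D a (b ∷ bs) = Arc D a b × PathArcs D b bs

ClosedArcs : (D : Digraph) → List (Vtx D) → Set
ClosedArcs D []       = ⊥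
ClosedArcs D (x ∷ xs) = PathArcs D x (xs ++ [ x ])

IsDirCycle : (D : Digraph) → List (Vtx D) → Set
IsDirCycle D xs = (2 ≤ length xs) × Unique xs × ClosedArcs D xs

DirCycle : Digraph → Set
DirCycle D = Σ (List (Vtx D)) (IsDirCycle D)

-- Two representations denote the same directed cycle iff one vertex list
-- is a cyclic rotation of the other.
Rot : {A : Set} → List A → List A → Set
Rot {A} xs ys = Σ (List A) λ as → Σ (List A) λ bs → (xs ≡ as ++ bs) × (ys ≡ bs ++ as)

_≈C_ : {D : Digraph} → DirCycle D → DirCycle D → Set
(xs , _) ≈C (ys , _) = Rot xs ys

-- Cycle graph C(D): vertices = directed cycles (up to ≈C), two distinct
-- cycles adjacent iff they share a vertex.
CAdj : (D : Digraph) → DirCycle D → DirCycle D → Set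
CAdj D c d = ¬ (c ≈C d) × ∃ λ v → (v ∈ proj₁ c) × (v ∈ proj₁ d)

record CycleGraphAut (D : Digraph) : Set where
  field
    f       : DirCycle D → DirCycle D
    resp    : ∀ c d → c ≈C d → f c ≈C f d
    inj     : ∀ c d → f c ≈C f d → c ≈C d
    surj    : ∀ d → Σ (DirCycle D) λ c → f c ≈C d
    adjPres : ∀ c d → CAdj D c d → CAdj D (f c) (f d)
    adjRefl : ∀ c d → CAdj D (f c) (f d) → CAdj D c d

CycleGraphNearlyTransitive : Digraph → Set
CycleGraphNearlyTransitive D =
  ∀ (u v : DirCycle D) → Σ (CycleGraphAut D) λ φ →
    (CycleGraphAut.f φ v ≈C u) ⊎ CAdj D u (CycleGraphAut.f φ v)

{-# OPTIONS --safe #-}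
-- An automorphism σ of D maps directed cycles to directed cycles by
-- relabelling their vertices, and this induces an automorphism of C(D).
-- Given cycles u ∋ x and v ∋ y, vertex transitivity provides σ with σ y = x,
-- so σ(v) passes through x: either σ(v) = u, or σ(v) and u are distinct
-- cycles sharing x, i.e. adjacent in C(D). Choosing between the two cases
-- constructively needs equality of cycles, i.e. rotation of vertex lists,
-- to be decidable.
module Submission where

open import Defs
open import Data.Nat using (_≤_)
open import Data.Bool using (T)
open import Data.Fin.Properties using (_≟_)
open import Data.Fin.Permutation using (Permutation′; _⟨$⟩ʳ_; _⟨$⟩ˡ_; inverseˡ; inverseʳ; flip)
open import Data.List using (List; []; _∷_; _++_; [_]; map)
open import Data.List.Properties using (≡-dec; map-id; map-∘; map-cong; map-++; length-map; ++-assoc; ++-identityʳ)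
open import Data.List.Relation.Unary.Any using (here)
open import Data.List.Relation.Unary.Unique.Propositional.Properties using (map⁺)
open import Data.List.Membership.Propositional using (_∈_)
open import Data.List.Membership.Propositional.Properties using (∈-map⁺; ∈-map⁻)
open import Data.Product using (∃; ∃₂; _×_; _,_; proj₁)
open import Data.Sum using (_⊎_; inj₁; inj₂)
open import Data.Unit using (tt)
open import Function using (_∘_; id; _⇔_; mk⇔)
open import Function.Bundles using (Injection)
open import Function.Construct.Symmetry using (⇔-sym)
open import Function.Properties.Inverse using (↔⇒↣)
open import Relation.Nullary using (Dec; yes; no)
open import Relation.Nullary.Decidable as Dec using (_⊎-dec_)
open import Relation.Binary.Definitions using (DecidableEquality)
open import Relation.Binary.PropositionalEquality
  using (_≡_; _≗_; refl; sym; trans; cong; cong₂; subst; subst₂)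

module _ {A : Set} where

  ≡⇒Rot : {xs ys : List A} → xs ≡ ys → Rot xs ys
  ≡⇒Rot {ys = ys} xs≡ys = [] , ys , xs≡ys , sym (++-identityʳ ys)

  Rot-sym : {xs ys : List A} → Rot xs ys → Rot ys xs
  Rot-sym (as , bs , xs≡ , ys≡) = bs , as , ys≡ , xs≡

  -- ys is pre ++ post rotated at a cut inside post; Rot is definitionally RotAt [].
  RotAt : List A → List A → List A → Set
  RotAt pre post ys = ∃₂ λ p q → post ≡ p ++ q × ys ≡ q ++ pre ++ p

  RotAt-[] : ∀ pre ys → RotAt pre [] ys ⇔ ys ≡ pre
  RotAt-[] pre ys = mk⇔ to from
    where
    to : RotAt pre [] ys → ys ≡ pre
    to ([] , [] , refl , ys≡) = trans ys≡ (++-identityʳ pre)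

    from : ys ≡ pre → RotAt pre [] ys
    from ys≡pre = [] , [] , refl , trans ys≡pre (sym (++-identityʳ pre))

  RotAt-∷ : ∀ pre x post ys →
            RotAt pre (x ∷ post) ys ⇔ (ys ≡ x ∷ post ++ pre ⊎ RotAt (pre ++ [ x ]) post ys)
  RotAt-∷ pre x post ys = mk⇔ to from
    where
    to : RotAt pre (x ∷ post) ys → ys ≡ x ∷ post ++ pre ⊎ RotAt (pre ++ [ x ]) post ys
    to ([] , q , refl , ys≡) = inj₁ (trans ys≡ (cong (q ++_) (++-identityʳ pre)))
    to (.x ∷ p , q , refl , ys≡) = inj₂ (p , q , refl , trans ys≡ (cong (q ++_) (sym (++-assoc pre [ x ] p))))

    from : ys ≡ x ∷ post ++ pre ⊎ RotAt (pre ++ [ x ]) post ys → RotAt pre (x ∷ post) ys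
    from (inj₁ ys≡) = [] , x ∷ post , refl , trans ys≡ (cong ((x ∷ post) ++_) (sym (++-identityʳ pre)))
    from (inj₂ (p , q , refl , ys≡)) = x ∷ p , q , refl , trans ys≡ (cong (q ++_) (++-assoc pre [ x ] p))

  RotAt? : DecidableEquality A → ∀ pre post ys → Dec (RotAt pre post ys)
  RotAt? _≟A_ pre [] ys = Dec.map (⇔-sym (RotAt-[] pre ys)) (≡-dec _≟A_ ys pre)
  RotAt? _≟A_ pre (x ∷ post) ys =
    Dec.map (⇔-sym (RotAt-∷ pre x post ys))
            (≡-dec _≟A_ ys (x ∷ post ++ pre) ⊎-dec RotAt? _≟A_ (pre ++ [ x ]) post ys)

  Rot? : DecidableEquality A → ∀ xs ys → Dec (Rot xs ys)
  Rot? _≟A_ = RotAt? _≟A_ []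

Rot-map : {A B : Set} (g : A → B) {xs ys : List A} → Rot xs ys → Rot (map g xs) (map g ys)
Rot-map g (as , bs , refl , refl) = map g as , map g bs , map-++ g as bs , map-++ g bs as

module MapLeftInverse {A B : Set} (g : A → B) (h : B → A) (h∘g≗id : h ∘ g ≗ id) where

  map-leftInverse : map h ∘ map g ≗ id
  map-leftInverse xs = trans (sym (map-∘ xs)) (trans (map-cong h∘g≗id xs) (map-id xs))

  Rot-unmap : {xs ys : List A} → Rot (map g xs) (map g ys) → Rot xs ys
  Rot-unmap {xs} {ys} = subst₂ Rot (map-leftInverse xs) (map-leftInverse ys) ∘ Rot-map h

  ∈-unmap : ∀ {w xs} → w ∈ map g xs → h w ∈ xs
  ∈-unmap w∈gxs with ∈-map⁻ g w∈gxs
  ... | x , x∈xs , refl = subst (_∈ _) (sym (h∘g≗id x)) x∈xs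

module _ {D E : Digraph} (g : Vtx D → Vtx E)
         (g-hom : ∀ {u v} → Arc D u v → Arc E (g u) (g v))
         (g-inj : ∀ {u v} → g u ≡ g v → u ≡ v) where

  PathArcs-map : ∀ {a} xs → PathArcs D a xs → PathArcs E (g a) (map g xs)
  PathArcs-map []       _            = tt
  PathArcs-map (b ∷ bs) (ab , rest) = g-hom ab , PathArcs-map bs rest

  ClosedArcs-map : ∀ xs → ClosedArcs D xs → ClosedArcs E (map g xs)
  ClosedArcs-map (x ∷ xs) closed =
    subst (PathArcs E (g x)) (map-++ g xs [ x ]) (PathArcs-map (xs ++ [ x ]) closed)

  DirCycle-map : DirCycle D → DirCycle E
  DirCycle-map (xs , long , unique , closed) =
    map g xs , subst (2 ≤_) (sym (length-map g xs)) long , map⁺ g-inj unique , ClosedArcs-map xs closed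

module _ {D : Digraph} where

  IsDigraphAut⇒hom : ∀ σ → IsDigraphAut D σ → ∀ {u v} → Arc D u v → Arc D (σ ⟨$⟩ʳ u) (σ ⟨$⟩ʳ v)
  IsDigraphAut⇒hom σ σ-aut {u} {v} = subst T (sym (σ-aut u v))

  IsDigraphAut-flip : ∀ σ → IsDigraphAut D σ → IsDigraphAut D (flip σ)
  IsDigraphAut-flip σ σ-aut u v =
    trans (sym (σ-aut (σ ⟨$⟩ˡ u) (σ ⟨$⟩ˡ v))) (cong₂ (arc D) (inverseʳ σ) (inverseʳ σ))

  permuteCycle : (σ : Permutation′ (n D)) → IsDigraphAut D σ → DirCycle D → DirCycle D
  permuteCycle σ σ-aut = DirCycle-map (σ ⟨$⟩ʳ_) (IsDigraphAut⇒hom σ σ-aut) (Injection.injective (↔⇒↣ σ))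

  cycleGraphAut : (σ : Permutation′ (n D)) → IsDigraphAut D σ → CycleGraphAut D
  cycleGraphAut σ σ-aut = record
    { f       = permuteCycle σ σ-aut
    ; resp    = λ _ _ → Rot-map (σ ⟨$⟩ʳ_)
    ; inj     = λ _ _ → Rot-unmap
    ; surj    = λ d → permuteCycle (flip σ) (IsDigraphAut-flip σ σ-aut) d
                    , ≡⇒Rot (map-rightInverse (proj₁ d))
    ; adjPres = λ { _ _ (c≉d , w , w∈c , w∈d) →
                    c≉d ∘ Rot-unmap , σ ⟨$⟩ʳ w , ∈-map⁺ _ w∈c , ∈-map⁺ _ w∈d }
    ; adjRefl = λ { _ _ (σc≉σd , w , w∈σc , w∈σd) →
                    σc≉σd ∘ Rot-map (σ ⟨$⟩ʳ_) , σ ⟨$⟩ˡ w , ∈-unmap w∈σc , ∈-unmap w∈σd }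
    }
    where
    open MapLeftInverse (σ ⟨$⟩ʳ_) (σ ⟨$⟩ˡ_) (λ _ → inverseˡ σ) using (Rot-unmap; ∈-unmap)
    open MapLeftInverse (σ ⟨$⟩ˡ_) (σ ⟨$⟩ʳ_) (λ _ → inverseʳ σ)
      using () renaming (map-leftInverse to map-rightInverse)

  DirCycle-vertex : (c : DirCycle D) → ∃ λ v → v ∈ proj₁ c
  DirCycle-vertex (v ∷ _ , _) = v , here refl

  sharedVertex⇒≈C⊎CAdj : ∀ {v} (c d : DirCycle D) → v ∈ proj₁ c → v ∈ proj₁ d → d ≈C c ⊎ CAdj D c d
  sharedVertex⇒≈C⊎CAdj {v} c d v∈c v∈d with Rot? _≟_ (proj₁ c) (proj₁ d)
  ... | yes c≈d = inj₁ (Rot-sym c≈d)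
  ... | no  c≉d = inj₂ (c≉d , v , v∈c , v∈d)

lemma2p10 : (D : Digraph) → Connected D → VertexTransitive D → CycleGraphNearlyTransitive D
lemma2p10 D _ transitive u v with DirCycle-vertex u | DirCycle-vertex v
... | x , x∈u | y , y∈v with transitive y x
... | σ , σ-aut , σy≡x =
  cycleGraphAut σ σ-aut ,
  sharedVertex⇒≈C⊎CAdj u (permuteCycle σ σ-aut v) x∈u
    (subst (_∈ map (σ ⟨$⟩ʳ_) (proj₁ v)) σy≡x (∈-map⁺ _ y∈v))
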